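{- Let $Z\subseteq\mathbb C^n$ be a finite set and let $\{c_{\mathbf a}\mid \mathbf a\in Z\}$ be complex constants. Then the lowest-degree nonzero homogeneous parts of the formal power series $\sum_{\mathbf a\in Z}c_{\mathbf a}e^{\mathbf a\cdot\mathbf x}$ and $\sum_{\mathbf a\in Z}c_{\mathbf a}(1+\mathbf x)^{\mathbf a}$ coincide.
   Context: For $\mathbf a=(a_1,\dots,a_n)\in\mathbb C^n$, $e^{\mathbf a\cdot\mathbf x}=e^{a_1x_1+\cdots+a_nx_n}$ and $(1+\mathbf x)^{\mathbf a}=(1+x_1)^{a_1}\cdots(1+x_n)^{a_n}$ are regarded as formal power series in $x_1,\dots,x_n$ expanded at the origin (with $(1+x_i)^{a_i}=\sum_{k\ge0}\binom{a_i}{k}x_i^k$). -}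

module Defs where

open import Level using (Level; _⊔_) renaming (suc to lsuc)
open import Algebra.Bundles using (CommutativeRing)
open import Data.Nat as ℕ using (ℕ; zero; suc; NonZero; _!)
open import Data.Nat.Properties using (_!≢0)
open import Data.Fin using (Fin; zero; suc)
open import Data.Product using (_×_)
open import Relation.Nullary using (¬_)
open import Relation.Binary.PropositionalEquality using (_≡_)

-- A field of characteristic zero (ℂ is the instance of interest).
ι : ∀ {c ℓ} (R : CommutativeRing c ℓ) → ℕ → CommutativeRing.Carrier R
ι R zero    = CommutativeRing.0# R
ι R (suc n) = CommutativeRing._+_ R (CommutativeRing.1# R) (ι R n)

record CharZeroField (c ℓ : Level) : Set (lsuc (c ⊔ ℓ)) where
  field
    commutativeRing : CommutativeRing c ℓ
  open CommutativeRing commutativeRing public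
  field
    1≉0      : ¬ (1# ≈ 0#)
    inv      : (x : Carrier) → ¬ (x ≈ 0#) → Carrier
    inv-law  : (x : Carrier) (x≉0 : ¬ (x ≈ 0#)) → x * inv x x≉0 ≈ 1#
    charZero : (k : ℕ) → .{{NonZero k}} → ¬ (ι commutativeRing k ≈ 0#)

module Series {c ℓ : Level} (F : CharZeroField c ℓ) where
  open CharZeroField F public hiding (zero)

  ιF : ℕ → Carrier
  ιF = ι commutativeRing

  ∑ : (N : ℕ) → (Fin N → Carrier) → Carrier
  ∑ zero    f = 0#
  ∑ (suc N) f = f zero + ∑ N (λ i → f (suc i))

  ∏ : (N : ℕ) → (Fin N → Carrier) → Carrier
  ∏ zero    f = 1#
  ∏ (suc N) f = f zero * ∏ N (λ i → f (suc i))

  pow : Carrier → ℕ → Carrier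
  pow x zero    = 1#
  pow x (suc k) = x * pow x k

  invFact : ℕ → Carrier
  invFact k = inv (ιF (k !)) (charZero (k !) {{k !≢0}})

  falling : Carrier → ℕ → Carrier
  falling x zero    = 1#
  falling x (suc k) = falling x k * (x - ιF k)

  binom : Carrier → ℕ → Carrier
  binom x k = falling x k * invFact k

  MultiIndex : ℕ → Set
  MultiIndex n = Fin n → ℕ

  deg : {n : ℕ} → MultiIndex n → ℕ
  deg {zero}  m = zero
  deg {suc n} m = m zero ℕ.+ deg {n} (λ i → m (suc i))

  PowerSeries : ℕ → Set c
  PowerSeries n = MultiIndex n → Carrier

  -- e^{a·x} = ∑_m (a^m / m!) x^m
  expSeries : {n : ℕ} → (Fin n → Carrier) → PowerSeries n
  expSeries {n} a m = ∏ n (λ i → pow (a i) (m i) * invFact (m i))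

  -- (1+x)^a = ∏_i ∑_k binom(a_i,k) x_i^k
  binomSeries : {n : ℕ} → (Fin n → Carrier) → PowerSeries n
  binomSeries {n} a m = ∏ n (λ i → binom (a i) (m i))

  HomPartZero : {n : ℕ} → PowerSeries n → ℕ → Set (ℓ)
  HomPartZero f d = ∀ m → deg m ≡ d → f m ≈ 0#

  LowestDegree : {n : ℕ} → PowerSeries n → ℕ → Set ℓ
  LowestDegree f d = (∀ k → k ℕ.< d → HomPartZero f k) × ¬ HomPartZero f d

  HomPartEq : {n : ℕ} → PowerSeries n → PowerSeries n → ℕ → Set ℓ
  HomPartEq f g d = ∀ m → deg m ≡ d → f m ≈ g m

  expSum : {n : ℕ} (N : ℕ) → (Fin N → Fin n → Carrier) → (Fin N → Carrier) → PowerSeries n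
  expSum N a cst m = ∑ N (λ j → cst j * expSeries (a j) m)

  binomSum : {n : ℕ} (N : ℕ) → (Fin N → Fin n → Carrier) → (Fin N → Carrier) → PowerSeries n
  binomSum N a cst m = ∑ N (λ j → cst j * binomSeries (a j) m)

{-# OPTIONS --safe #-}
-- The coefficient of x^m in ∑ c_a (1+x)^a is
-- ∑_a c_a ∏_i falling(a_i, m_i)/m_i!, and that of ∑ c_a e^{a·x} is the same with
-- a_i^{m_i} instead of falling(a_i, m_i). As falling t k is t^k plus lower powers of t,
-- the two coefficients differ by a combination of exponential coefficients of lower
-- total degree, so they agree as soon as the exponential series vanishes below |m|.
-- The variables are removed one at a time: in the first one, falling and power give
-- the same sum against any weights whose lower moments ∑_j w_j t_j^l vanish.
module Submission where

open import Defs
open import Data.Nat using (ℕ)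
open import Data.Fin using (Fin)
open import Data.Product using (_×_)
open import Function.Bundles using (_⇔_)
open import Relation.Binary.PropositionalEquality using (_≡_)

open import Level using (Level)
open import Data.Nat as ℕ using (zero; suc; _<_; _≤_; s≤s; _!)
import Data.Nat.Properties as ℕₚ
open import Data.Fin using (zero; suc)
open import Data.Product using (_,_)
open import Data.Sum using (inj₁; inj₂)
open import Data.Vec.Functional using (_∷_; tail)
open import Function.Bundles using (mk⇔)
import Relation.Binary.PropositionalEquality as ≡

module _ {c ℓ : Level} (F : CharZeroField c ℓ) where
  open Series F
  import Algebra.Properties.Semiring.Sum semiring as Sum
  open import Algebra.Solver.Ring.NaturalCoefficients.Default commutativeSemiring
    using (solve; _:+_; _:*_; _:=_)
  open import Relation.Binary.Reasoning.Setoid setoid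

  ∑≡sum : ∀ N (f : Fin N → Carrier) → ∑ N f ≡ Sum.sum f
  ∑≡sum zero    f = ≡.refl
  ∑≡sum (suc N) f = ≡.cong (f zero +_) (∑≡sum N (tail f))

  ∑-cong : ∀ N {f g : Fin N → Carrier} → (∀ i → f i ≈ g i) → ∑ N f ≈ ∑ N g
  ∑-cong N {f} {g} f≈g rewrite ∑≡sum N f | ∑≡sum N g = Sum.sum-cong-≋ f≈g

  ∑-distrib-+ : ∀ N (f g : Fin N → Carrier) → ∑ N (λ i → f i + g i) ≈ ∑ N f + ∑ N g
  ∑-distrib-+ N f g
    rewrite ∑≡sum N (λ i → f i + g i) | ∑≡sum N f | ∑≡sum N g = Sum.∑-distrib-+ f g

  *-distribˡ-∑ : ∀ N x (f : Fin N → Carrier) → x * ∑ N f ≈ ∑ N (λ i → x * f i)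
  *-distribˡ-∑ N x f rewrite ∑≡sum N f | ∑≡sum N (λ i → x * f i) = Sum.*-distribˡ-sum x f

  cancel-unitˡ : ∀ {u v y} → v * u ≈ 1# → u * y ≈ 0# → y ≈ 0#
  cancel-unitˡ {u} {v} {y} vu≈1 uy≈0 = begin
    y              ≈⟨ *-identityˡ y ⟨
    1# * y         ≈⟨ *-congʳ vu≈1 ⟨
    (v * u) * y    ≈⟨ *-assoc v u y ⟩
    v * (u * y)    ≈⟨ *-congˡ uy≈0 ⟩
    v * 0#         ≈⟨ zeroʳ v ⟩
    0#             ∎

  invFact-cancel : ∀ l {y} → invFact l * y ≈ 0# → y ≈ 0#
  invFact-cancel l = cancel-unitˡ (inv-law (ιF (l !)) _)

  -- The induction goes through because it is over all weights: multiplying the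
  -- weights by t_j shifts the moments, and falling t (1+k) = t·falling t k − k·falling t k.
  ∑-falling≈∑-pow : ∀ k {N} (w t : Fin N → Carrier) →
    (∀ l → l < k → ∑ N (λ j → w j * pow (t j) l) ≈ 0#) →
    ∑ N (λ j → w j * falling (t j) k) ≈ ∑ N (λ j → w j * pow (t j) k)
  ∑-falling≈∑-pow zero    w t _ = refl
  ∑-falling≈∑-pow (suc k) {N} w t lowMoments = begin
    ∑ N (λ j → w j * (falling (t j) k * (t j - ιF k)))
      ≈⟨ ∑-cong N (λ j → expand (w j) (t j) (falling (t j) k)) ⟩
    ∑ N (λ j → (w j * t j) * falling (t j) k + - ιF k * (w j * falling (t j) k))
      ≈⟨ ∑-distrib-+ N _ _ ⟩
    ∑ N (λ j → (w j * t j) * falling (t j) k) + ∑ N (λ j → - ιF k * (w j * falling (t j) k))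
      ≈⟨ +-cong (∑-falling≈∑-pow k (λ j → w j * t j) t shiftedMoments)
                (sym (*-distribˡ-∑ N _ _)) ⟩
    ∑ N (λ j → (w j * t j) * pow (t j) k) + - ιF k * ∑ N (λ j → w j * falling (t j) k)
      ≈⟨ +-cong (∑-cong N (λ j → *-assoc _ _ _))
                (*-congˡ (∑-falling≈∑-pow k w t (λ l l<k → lowMoments l (ℕₚ.m<n⇒m<1+n l<k)))) ⟩
    ∑ N (λ j → w j * pow (t j) (suc k)) + - ιF k * ∑ N (λ j → w j * pow (t j) k)
      ≈⟨ +-congˡ (*-congˡ (lowMoments k (ℕₚ.n<1+n k))) ⟩
    ∑ N (λ j → w j * pow (t j) (suc k)) + - ιF k * 0#
      ≈⟨ +-congˡ (zeroʳ _) ⟩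
    ∑ N (λ j → w j * pow (t j) (suc k)) + 0#
      ≈⟨ +-identityʳ _ ⟩
    ∑ N (λ j → w j * pow (t j) (suc k)) ∎
    where
    expand : ∀ w t φ → w * (φ * (t - ιF k)) ≈ (w * t) * φ + - ιF k * (w * φ)
    expand w t φ = solve 4 (λ w t φ c → w :* (φ :* (t :+ c)) := (w :* t) :* φ :+ c :* (w :* φ))
                           refl w t φ (- ιF k)
    shiftedMoments : ∀ l → l < k → ∑ N (λ j → (w j * t j) * pow (t j) l) ≈ 0#
    shiftedMoments l l<k = trans (∑-cong N (λ j → *-assoc _ _ _)) (lowMoments (suc l) (s≤s l<k))

  module FirstVariable {n N : ℕ} (a : Fin N → Fin (suc n) → Carrier) (cst : Fin N → Carrier) where
    t : Fin N → Carrier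
    t j = a j zero

    a′ : Fin N → Fin n → Carrier
    a′ j = tail (a j)

    cst[_] : ℕ → Fin N → Carrier
    cst[ l ] j = cst j * pow (t j) l

    expSum-split : ∀ m → expSum N a cst m ≈ invFact (m zero) * expSum N a′ cst[ m zero ] (tail m)
    expSum-split m = trans (∑-cong N (λ j → regroup _ _ _ _)) (sym (*-distribˡ-∑ N _ _))
      where
      regroup : ∀ c p i e → c * ((p * i) * e) ≈ i * ((c * p) * e)
      regroup = solve 4 (λ c p i e → c :* ((p :* i) :* e) := i :* ((c :* p) :* e)) refl

    binomSum-split : ∀ m → binomSum N a cst m ≈
      invFact (m zero) * ∑ N (λ j → (cst j * binomSeries (a′ j) (tail m)) * falling (t j) (m zero))
    binomSum-split m = trans (∑-cong N (λ j → regroup _ _ _ _)) (sym (*-distribˡ-∑ N _ _))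
      where
      regroup : ∀ c φ i b → c * ((φ * i) * b) ≈ i * ((c * b) * φ)
      regroup = solve 4 (λ c φ i b → c :* ((φ :* i) :* b) := i :* ((c :* b) :* φ)) refl

    binomSum-moment : ∀ l q →
      ∑ N (λ j → (cst j * binomSeries (a′ j) q) * pow (t j) l) ≈ binomSum N a′ cst[ l ] q
    binomSum-moment l q = ∑-cong N (λ j → regroup _ _ _)
      where
      regroup : ∀ c b p → (c * b) * p ≈ (c * p) * b
      regroup = solve 3 (λ c b p → (c :* b) :* p := (c :* p) :* b) refl

  binomSum≈expSum : ∀ n N (a : Fin N → Fin n → Carrier) cst (m : MultiIndex n) →
    (∀ p → deg p < deg m → expSum N a cst p ≈ 0#) → binomSum N a cst m ≈ expSum N a cst m
  binomSum≈expSum zero    N a cst m _ = refl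
  binomSum≈expSum (suc n) N a cst m vanish = begin
    binomSum N a cst m                                ≈⟨ binomSum-split m ⟩
    invFact m₀ * ∑ N (λ j → w j * falling (t j) m₀)   ≈⟨ *-congˡ (∑-falling≈∑-pow m₀ w t lowMoments) ⟩
    invFact m₀ * ∑ N (λ j → w j * pow (t j) m₀)       ≈⟨ *-congˡ (moment≈expSum m₀ ℕₚ.≤-refl) ⟩
    invFact m₀ * expSum N a′ cst[ m₀ ] (tail m)       ≈⟨ expSum-split m ⟨
    expSum N a cst m                                  ∎
    where
    open FirstVariable a cst
    m₀ : ℕ
    m₀ = m zero
    w : Fin N → Carrier
    w j = cst j * binomSeries (a′ j) (tail m)
    vanish′ : ∀ l q → l ℕ.+ deg q < deg m → expSum N a′ cst[ l ] q ≈ 0#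
    vanish′ l q <deg = invFact-cancel l (trans (sym (expSum-split (l ∷ q))) (vanish (l ∷ q) <deg))
    moment≈expSum : ∀ l → l ≤ m₀ → ∑ N (λ j → w j * pow (t j) l) ≈ expSum N a′ cst[ l ] (tail m)
    moment≈expSum l l≤m₀ = trans (binomSum-moment l (tail m))
      (binomSum≈expSum n N a′ cst[ l ] (tail m) (λ q <deg → vanish′ l q (ℕₚ.+-mono-≤-< l≤m₀ <deg)))
    lowMoments : ∀ l → l < m₀ → ∑ N (λ j → w j * pow (t j) l) ≈ 0#
    lowMoments l l<m₀ = trans (moment≈expSum l (ℕₚ.<⇒≤ l<m₀))
      (vanish′ l (tail m) (ℕₚ.+-monoˡ-< (deg (tail m)) l<m₀))

  VanishingBelow : {n : ℕ} → PowerSeries n → ℕ → Set ℓ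
  VanishingBelow f d = ∀ k → k < d → HomPartZero f k

  HomPartEq-sym : ∀ {n d} {f g : PowerSeries n} → HomPartEq f g d → HomPartEq g f d
  HomPartEq-sym f≈g m deg≡ = sym (f≈g m deg≡)

  HomPartZero-resp : ∀ {n d} {f g : PowerSeries n} → HomPartEq f g d → HomPartZero g d → HomPartZero f d
  HomPartZero-resp f≈g g≈0 m deg≡ = trans (f≈g m deg≡) (g≈0 m deg≡)

  VanishingBelow-suc : ∀ {n d} {f : PowerSeries n} →
    VanishingBelow f d → HomPartZero f d → VanishingBelow f (suc d)
  VanishingBelow-suc below f≈0 k k<1+d with ℕₚ.m<1+n⇒m<n∨m≡n k<1+d
  ... | inj₁ k<d  = below k k<d
  ... | inj₂ ≡.refl = f≈0

  module _ {n : ℕ} {f g : PowerSeries n}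
           (agree : ∀ k → VanishingBelow f k → HomPartEq f g k) where

    VanishingBelow⇒ : ∀ {d} → VanishingBelow f d → VanishingBelow g d
    VanishingBelow⇒ below k k<d =
      HomPartZero-resp (HomPartEq-sym (agree k (λ k′ k′<k → below k′ (ℕₚ.<-trans k′<k k<d))))
                       (below k k<d)

    VanishingBelow⇐ : ∀ d → VanishingBelow g d → VanishingBelow f d
    VanishingBelow⇐ zero    _     _ ()
    VanishingBelow⇐ (suc d) below = VanishingBelow-suc belowᶠ
      (HomPartZero-resp (agree d belowᶠ) (below d (ℕₚ.n<1+n d)))
      where
      belowᶠ : VanishingBelow f d
      belowᶠ = VanishingBelow⇐ d (λ k k<d → below k (ℕₚ.m<n⇒m<1+n k<d))

    LowestDegree⇔ : ∀ d → LowestDegree f d ⇔ LowestDegree g d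
    LowestDegree⇔ d = mk⇔
      (λ (below , f≉0) → VanishingBelow⇒ below ,
                          λ g≈0 → f≉0 (HomPartZero-resp (agree d below) g≈0))
      (λ (below , g≉0) → let belowᶠ = VanishingBelow⇐ d below in
                          belowᶠ , λ f≈0 → g≉0 (HomPartZero-resp (HomPartEq-sym (agree d belowᶠ)) f≈0))

lemma3p2 : ∀ {c ℓ} (F : CharZeroField c ℓ) → let open Series F in
    (n N : ℕ) (a : Fin N → Fin n → Carrier) (cst : Fin N → Carrier) →
    (∀ i j → (∀ k → a i k ≈ a j k) → i ≡ j) →
    ∀ d → (LowestDegree (expSum N a cst) d ⇔ LowestDegree (binomSum N a cst) d)
    × (LowestDegree (expSum N a cst) d → HomPartEq (expSum N a cst) (binomSum N a cst) d)
-- The points a_j need not be distinct: the argument never uses that hypothesis.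
lemma3p2 F n N a cst _ d = LowestDegree⇔ F agree d , λ (below , _) → agree d below
  where
  open Series F
  agree : ∀ k → VanishingBelow F (expSum N a cst) k → HomPartEq (expSum N a cst) (binomSum N a cst) k
  agree k below m ≡.refl = sym (binomSum≈expSum F n N a cst m (λ p <deg → below (deg p) <deg p ≡.refl))
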